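{- Let $(G,L_G)$ be a graft whose adjacency matrix $\mathbf A$ is non-singular over $\mathrm{GF}(2)$, and let $(G',L_{G'})$ be the graft (on vertex set $V(G)$) whose adjacency matrix is $\mathbf A^{ -1}$. Then \[ P^{\langle\tau\delta\tau\rangle}_{(G,L_G)}(z)=P^{\langle\tau\rangle}_{(G',L_{G'})}(z)\quad\text{and}\quad P^{\langle\delta\tau\rangle}_{(G,L_G)}(z)=P^{\langle\tau\delta\rangle}_{(G',L_{G'})}(z). \]
   Context: A graft $(G,L_G)$ is a simple graph $G$ with a subset $L_G\subseteq V(G)$; its adjacency matrix $\mathbf A_{(G,L_G)}$ is the symmetric $V(G)\times V(G)$ matrix over $\mathrm{GF}(2)$ with $(u,v)$-entry $1$ iff ($u\ne v$ and $u,v$ adjacent) or ($u=v\in L_G$), and $0$ otherwise; every symmetric matrix over $\mathrm{GF}(2)$ indexed by $V(G)$ is the adjacency matrix of a unique graft. For a square matrix $M$ indexed by $V$ and $A\subseteq V$: $M[A]$ is the principal submatrix on $A$, $A^c=V\setminus A$, $I_A$ is the diagonal $0/1$ matrix with $1$s exactly at $A$, $\operatorname{corank}$ = size minus rank (empty matrices have rank $0$). Define $r_{\langle\tau\rangle}(M,A)=\operatorname{rank}(M+I_A)$, $r_{\langle\delta\tau\rangle}(M,A)=\operatorname{rank}((M+I_A)[A])+\operatorname{rank}(M[A^c])$, $r_{\langle\tau\delta\rangle}(M,A)=\operatorname{rank}(M+I_A)-\operatorname{corank}(M[A])$, $r_{\langle\tau\delta\tau\rangle}(M,A)=\operatorname{rank}(M)-\operatorname{corank}((M+I_A)[A])$,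 $P_{\langle\bullet\rangle}(M,z)=\sum_{A\subseteq V} z^{r_{\langle\bullet\rangle}(M,A)}$, and $P^{\langle\bullet\rangle}_{(G,L_G)}(z):=P_{\langle\bullet\rangle}(\mathbf A_{(G,L_G)},z)$. -}

module Defs where

open import Data.Bool using (Bool; true; false; _∧_; _∨_; _xor_; not; if_then_else_)
open import Data.Nat using (ℕ; zero; suc; _⊔_)
open import Data.Integer using (ℤ; +_; _-_; _+_)
open import Data.Fin using (Fin; _≟_)
open import Data.List using (List; []; _∷_; map; foldr; length; filter; allFin; _++_; concatMap)
open import Data.Bool.ListAction using (any; all)
open import Relation.Nullary using (does)
open import Relation.Binary.PropositionalEquality using (_≡_)

-- GF(2) is modelled by Bool: addition = _xor_, multiplication = _∧_.
-- A square matrix indexed by V = Fin n is a function Fin n → Fin n → Bool.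

Mat : ℕ → Set
Mat n = Fin n → Fin n → Bool

⊕ : List Bool → Bool
⊕ = foldr _xor_ false

_==_ : ∀ {n} → Fin n → Fin n → Bool
i == j = does (i ≟ j)

identity : ∀ {n} → Mat n
identity i j = i == j

_·_ : ∀ {n} → Mat n → Mat n → Mat n
(M · N) i j = ⊕ (map (λ k → M i k ∧ N k j) (allFin _))

_+M_ : ∀ {n} → Mat n → Mat n → Mat n
(M +M N) i j = M i j xor N i j

_≐_ : ∀ {n} → Mat n → Mat n → Set
M ≐ N = ∀ i j → M i j ≡ N i j

IsInverseOf : ∀ {n} → Mat n → Mat n → Set
IsInverseOf N M = ((M · N) ≐ identity) × ((N · M) ≐ identity)
  where open import Data.Product using (_×_)

Subset : ℕ → Set
Subset n = Fin n → Bool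

allSubsets : (n : ℕ) → List (Subset n)
allSubsets zero = (λ ()) ∷ []
allSubsets (suc n) =
  concatMap (λ S → ext false S ∷ ext true S ∷ []) (allSubsets n)
  where
  ext : Bool → Subset n → Subset (suc n)
  ext b S Fin.zero = b
  ext b S (Fin.suc i) = S i

elems : ∀ {n} → Subset n → List (Fin n)
elems A = filter (λ i → Data.Bool._≟_ (A i) true) (allFin _)
  where import Data.Bool

complement : ∀ {n} → Subset n → Subset n
complement A i = not (A i)

diagI : ∀ {n} → Subset n → Mat n
diagI A i j = (i == j) ∧ A i

-- For a matrix M, a list R of row indices and a list C of column indices,
-- rankOn M R C is the rank of the submatrix of M with rows R and columns C,
-- defined as the maximum size of a linearly independent set of its columns
-- (over GF(2): no nonempty subfamily sums to the zero vector).

sublists : ∀ {a} {X : Set a} → List X → List (List X)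
sublists [] = [] ∷ []
sublists (x ∷ xs) = let ys = sublists xs in ys ++ map (x ∷_) ys

nonEmpty : ∀ {a} {X : Set a} → List X → Bool
nonEmpty [] = false
nonEmpty (_ ∷ _) = true

sumNonzero : ∀ {n} → Mat n → List (Fin n) → List (Fin n) → Bool
sumNonzero M R T = any (λ r → ⊕ (map (λ c → M r c) T)) R

independent : ∀ {n} → Mat n → List (Fin n) → List (Fin n) → Bool
independent M R S = all (λ T → not (nonEmpty T) ∨ sumNonzero M R T) (sublists S)

maximum : List ℕ → ℕ
maximum = foldr _⊔_ 0

rankOn : ∀ {n} → Mat n → List (Fin n) → List (Fin n) → ℕ
rankOn M R C = maximum (map length (filter (λ S → Data.Bool._≟_ (independent M R S) true) (sublists C)))
  where import Data.Bool

rank : ∀ {n} → Mat n → ℕ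
rank M = rankOn M (allFin _) (allFin _)

rankP : ∀ {n} → Mat n → Subset n → ℕ
rankP M A = rankOn M (elems A) (elems A)

corankP : ∀ {n} → Mat n → Subset n → ℤ
corankP M A = + length (elems A) - + rankP M A

-- The four rank functions (integer valued, since differences occur).

r-τ : ∀ {n} → Mat n → Subset n → ℤ
r-τ M A = + rank (M +M diagI A)

r-δτ : ∀ {n} → Mat n → Subset n → ℤ
r-δτ M A = + rankP (M +M diagI A) A + + rankP M (complement A)

r-τδ : ∀ {n} → Mat n → Subset n → ℤ
r-τδ M A = + rank (M +M diagI A) - corankP M A

r-τδτ : ∀ {n} → Mat n → Subset n → ℤ
r-τδτ M A = + rank M - corankP (M +M diagI A) A

-- Generating (Laurent) polynomial P(M,z) = Σ_{A ⊆ V} z^{r(M,A)}, represented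
-- by its coefficient function: the coefficient of z^k is the number of
-- subsets A with r(M,A) = k.

coeffP : ∀ {n} → (Mat n → Subset n → ℤ) → Mat n → ℤ → ℕ
coeffP {n} r M k =
  length (filter (λ A → Data.Integer._≟_ (r M A) k) (allSubsets n))
  where import Data.Integer

_≈P_ : (ℤ → ℕ) → (ℤ → ℕ) → Set
p ≈P q = ∀ k → p k ≡ q k

record Graft (n : ℕ) : Set where
  field
    adj   : Fin n → Fin n → Bool
    adj-sym   : ∀ u v → adj u v ≡ adj v u
    adj-irrefl : ∀ u → adj u u ≡ false
    L     : Subset n

adjMat : ∀ {n} → Graft n → Mat n
adjMat G u v = if u == v then Graft.L G u else Graft.adj G u v

P-τ P-δτ P-τδ P-τδτ : ∀ {n} → Graft n → ℤ → ℕ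
P-τ   G = coeffP r-τ   (adjMat G)
P-δτ  G = coeffP r-δτ  (adjMat G)
P-τδ  G = coeffP r-τδ  (adjMat G)
P-τδτ G = coeffP r-τδτ (adjMat G)

-- Write B = A⁻¹.  Over GF(2), A (B + I_X) = I + A I_X: its columns outside X are unit vectors
-- and its X × X block is (A + I_X)[X].  Multiplying by an invertible matrix preserves rank, and a
-- set Z of unit columns contributes exactly |Z| to the rank on top of the block on Zᶜ × Zᶜ, so
--   rank (B + I_X) = |Xᶜ| + rank (A + I_X)[X].
-- The same two facts, applied to A E and E where E has unit columns on X and agrees with B
-- elsewhere, give the complementary-minor identity |Xᶜ| + rank A[X] = |X| + rank B[Xᶜ].
-- Substituting them into the rank functions yields r⟨τδτ⟩(A, X) = r⟨τ⟩(B, X) and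
-- r⟨δτ⟩(A, X) = r⟨τδ⟩(B, X) for every X, so the generating polynomials agree coefficientwise.
module Submission where

open import Defs

open import Algebra.Bundles using (CommutativeRing)
open import Data.Bool using (Bool; true; false; _∧_; _∨_; _xor_; not; if_then_else_; T)
import Data.Bool as Bool
open import Data.Bool.Properties
  using (xor-∧-commutativeRing; ∧-distribˡ-xor; ∧-identityʳ; ∧-zeroʳ; ∧-comm; ∧-assoc;
         xor-comm; xor-identityʳ; ∨-zeroʳ; not-involutive; T-≡)
open import Data.Fin using (Fin; zero; suc)
import Data.Fin as Fin
import Data.Fin.Properties as Fin
open import Data.Integer using (ℤ)
import Data.Integer as Int
import Data.Integer.Properties as IntP
open import Data.Integer.Tactic.RingSolver using (solve-∀)
open import Data.List using (List; []; _∷_; map; filter; length; tabulate; allFin; _++_)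
open import Data.List.Properties
  using (map-tabulate; length-map; map-∘; map-++; filter-≐; filter-all; filter-none)
open import Data.List.Membership.Propositional using (_∈_; find; lose)
open import Data.List.Membership.Propositional.Properties
  using (∈-map⁺; ∈-map⁻; ∈-++⁺ˡ; ∈-++⁺ʳ; ∈-++⁻; ∈-filter⁺; ∈-filter⁻; ∈-allFin)
open import Data.List.Relation.Unary.Any using (here; there)
open import Data.List.Relation.Unary.Any.Properties using (any⁺; any⁻)
import Data.List.Relation.Unary.All as All
open import Data.List.Relation.Unary.All.Properties using (all⁺; all⁻)
open import Data.Nat using (ℕ; zero; suc; _+_; _⊔_; _≤_; s≤s)
open import Data.Nat.Properties
  using (module ≤-Reasoning; ≤-refl; ≤-trans; ≤-antisym; n≤1+n; m≤m+n; +-suc; +-monoʳ-≤;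
         m≤m⊔n; m≤n⊔m; ⊔-sel)
open import Data.Product using (∃; _×_; _,_; proj₂)
open import Data.Sum using (_⊎_; inj₁; inj₂)
import Data.Sum as Sum
open import Data.Vec.Functional using () renaming (_∷_ to _◂_)
open import Function using (_∘_; id; case_of_; Equivalence)
open import Relation.Binary.PropositionalEquality
open import Relation.Nullary using (Dec; yes; no)
open import Relation.Nullary.Decidable using (_×-dec_; _→-dec_; _⊎-dec_)

open import Algebra.Properties.Semiring.Sum (CommutativeRing.semiring xor-∧-commutativeRing)
  using (sum; sum-cong-≗; sum-replicate-zero; ∑-comm; ∑-distrib-+; *-distribˡ-sum; *-distribʳ-sum)

==-sym : ∀ {n} (i j : Fin n) → (i == j) ≡ (j == i)
==-sym zero    zero    = refl
==-sym zero    (suc j) = refl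
==-sym (suc i) zero    = refl
==-sym (suc i) (suc j) = ==-sym i j

==-refl : ∀ {n} (i : Fin n) → (i == i) ≡ true
==-refl zero    = refl
==-refl (suc i) = ==-refl i

==⇒≡ : ∀ {n} {i j : Fin n} → (i == j) ≡ true → i ≡ j
==⇒≡ {i = zero}  {zero}  _ = refl
==⇒≡ {i = suc i} {suc j} e = cong suc (==⇒≡ e)

sum-zero : ∀ {n} {f : Fin n → Bool} → (∀ k → f k ≡ false) → sum f ≡ false
sum-zero {n} f≗0 = trans (sum-cong-≗ f≗0) (sum-replicate-zero n)

sum-δʳ : ∀ {n} (f : Fin n → Bool) k → sum (λ j → f j ∧ (j == k)) ≡ f k
sum-δʳ f zero =
  trans (cong₂ _xor_ (∧-identityʳ (f zero)) (sum-zero (λ j → ∧-zeroʳ (f (suc j)))))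
        (xor-identityʳ (f zero))
sum-δʳ f (suc k) =
  trans (cong (_xor sum (λ j → f (suc j) ∧ (j == k))) (∧-zeroʳ (f zero))) (sum-δʳ (f ∘ suc) k)

sum-δˡ : ∀ {n} (f : Fin n → Bool) k → sum (λ j → (k == j) ∧ f j) ≡ f k
sum-δˡ f k = trans (sum-cong-≗ (λ j → trans (cong (_∧ f j) (==-sym k j)) (∧-comm (j == k) (f j))))
                   (sum-δʳ f k)

⊕-tabulate : ∀ {n} (f : Fin n → Bool) → ⊕ (tabulate f) ≡ sum f
⊕-tabulate {zero}  f = refl
⊕-tabulate {suc n} f = cong (f zero xor_) (⊕-tabulate (f ∘ suc))

·-entry : ∀ {n} (M N : Mat n) i j → (M · N) i j ≡ sum (λ k → M i k ∧ N k j)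
·-entry M N i j =
  trans (cong ⊕ (map-tabulate id (λ k → M i k ∧ N k j))) (⊕-tabulate (λ k → M i k ∧ N k j))

infixr 7 _·ᵥ_

_·ᵥ_ : ∀ {n} → Mat n → (Fin n → Bool) → Fin n → Bool
(M ·ᵥ v) r = sum (λ k → M r k ∧ v k)

module _ {n : ℕ} where

  ·ᵥ-congˡ : {M M' : Mat n} → M ≐ M' → ∀ v r → (M ·ᵥ v) r ≡ (M' ·ᵥ v) r
  ·ᵥ-congˡ M≐M' v r = sum-cong-≗ (λ k → cong (_∧ v k) (M≐M' r k))

  ·ᵥ-congʳ : (M : Mat n) {v w : Fin n → Bool} → (∀ k → v k ≡ w k) →
             ∀ r → (M ·ᵥ v) r ≡ (M ·ᵥ w) r
  ·ᵥ-congʳ M v≗w r = sum-cong-≗ (λ k → cong (M r k ∧_) (v≗w k))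

  ·ᵥ-zero : (M : Mat n) {v : Fin n → Bool} → (∀ k → v k ≡ false) →
            ∀ r → (M ·ᵥ v) r ≡ false
  ·ᵥ-zero M v≗0 r = sum-zero (λ k → trans (cong (M r k ∧_) (v≗0 k)) (∧-zeroʳ (M r k)))

  ·ᵥ-xor : (M : Mat n) (v w : Fin n → Bool) (r : Fin n) →
           (M ·ᵥ (λ k → v k xor w k)) r ≡ (M ·ᵥ v) r xor (M ·ᵥ w) r
  ·ᵥ-xor M v w r = trans (sum-cong-≗ (λ k → ∧-distribˡ-xor (M r k) (v k) (w k)))
                         (∑-distrib-+ (λ k → M r k ∧ v k) (λ k → M r k ∧ w k))

  identity-·ᵥ : (v : Fin n → Bool) (r : Fin n) → (identity ·ᵥ v) r ≡ v r
  identity-·ᵥ v r = sum-δˡ v r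

  ·-·ᵥ : (A M : Mat n) (v : Fin n → Bool) (r : Fin n) →
         ((A · M) ·ᵥ v) r ≡ (A ·ᵥ M ·ᵥ v) r
  ·-·ᵥ A M v r = begin
    sum (λ k → (A · M) r k ∧ v k)
      ≡⟨ sum-cong-≗ (λ k → cong (_∧ v k) (·-entry A M r k)) ⟩
    sum (λ k → sum (λ j → A r j ∧ M j k) ∧ v k)
      ≡⟨ sum-cong-≗ (λ k → *-distribʳ-sum (v k) (λ j → A r j ∧ M j k)) ⟩
    sum (λ k → sum (λ j → (A r j ∧ M j k) ∧ v k))
      ≡⟨ ∑-comm (λ k j → (A r j ∧ M j k) ∧ v k) ⟩
    sum (λ j → sum (λ k → (A r j ∧ M j k) ∧ v k))
      ≡⟨ sum-cong-≗ (λ j → sum-cong-≗ (λ k → ∧-assoc (A r j) (M j k) (v k))) ⟩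
    sum (λ j → sum (λ k → A r j ∧ (M j k ∧ v k)))
      ≡⟨ sum-cong-≗ (λ j → sym (*-distribˡ-sum (A r j) (λ k → M j k ∧ v k))) ⟩
    sum (λ j → A r j ∧ sum (λ k → M j k ∧ v k))
      ∎
    where open ≡-Reasoning

  leftInvertible⇒kernel-zero : {A B : Mat n} → (B · A) ≐ identity →
    ∀ v → (∀ r → (A ·ᵥ v) r ≡ false) → ∀ k → v k ≡ false
  leftInvertible⇒kernel-zero {A} {B} BA≐I v Av≗0 k = begin
    v k                      ≡⟨ sym (identity-·ᵥ v k) ⟩
    (identity ·ᵥ v) k        ≡⟨ sym (·ᵥ-congˡ BA≐I v k) ⟩
    ((B · A) ·ᵥ v) k         ≡⟨ ·-·ᵥ B A v k ⟩
    (B ·ᵥ A ·ᵥ v) k          ≡⟨ ·ᵥ-zero B Av≗0 k ⟩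
    false                    ∎
    where open ≡-Reasoning

infix 4 _⊆_
infixl 6 _─_

_⊆_ : ∀ {n} → Subset n → Subset n → Set
W ⊆ X = ∀ k → W k ≡ true → X k ≡ true

full empty : ∀ {n} → Subset n
full  _ = true
empty _ = false

_─_ : ∀ {n} → Subset n → Fin n → Subset n
(R ─ r) k = R k ∧ not (k == r)

complement-true : ∀ {n} (X : Subset n) {k} → complement X k ≡ true → X k ≡ false
complement-true X {k} Xᶜk = trans (sym (not-involutive (X k))) (cong not Xᶜk)

ZeroOn : ∀ {n} → Subset n → (Fin n → Bool) → Set
ZeroOn R v = ∀ r → R r ≡ true → v r ≡ false

⊆-empty : ∀ {n} {W : Subset n} → W ⊆ empty → ∀ k → W k ≡ false
⊆-empty {W = W} W⊆∅ k with W k in eq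
... | false = refl
... | true  with () ← W⊆∅ k eq

card : ∀ {n} → Subset n → ℕ
card {zero}  Y = 0
card {suc n} Y = if Y zero then suc (card (Y ∘ suc)) else card (Y ∘ suc)

card-cong : ∀ {n} {Y Y' : Subset n} → (∀ k → Y k ≡ Y' k) → card Y ≡ card Y'
card-cong {zero}  Y≗Y' = refl
card-cong {suc n} Y≗Y' =
  cong₂ (λ b m → if b then suc m else m) (Y≗Y' zero) (card-cong (Y≗Y' ∘ suc))

card-empty : ∀ n → card {n} empty ≡ 0
card-empty zero    = refl
card-empty (suc n) = card-empty n

card-full : ∀ n → card {n} full ≡ n
card-full zero    = refl
card-full (suc n) = cong suc (card-full n)

card-complement : ∀ {n} (X : Subset n) → card X + card (complement X) ≡ n
card-complement {zero}  X = refl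
card-complement {suc n} X with X zero
... | true  = cong suc (card-complement (X ∘ suc))
... | false = trans (+-suc (card (X ∘ suc)) _) (cong suc (card-complement (X ∘ suc)))

card-─ : ∀ {n} (Y : Subset n) y → card Y ≤ suc (card (Y ─ y))
card-─ {suc n} Y zero
  rewrite ∧-zeroʳ (Y zero) | card-cong {Y = (Y ─ zero) ∘ suc} (λ k → ∧-identityʳ (Y (suc k)))
  with Y zero
... | true  = ≤-refl
... | false = n≤1+n _
card-─ {suc n} Y (suc y) rewrite ∧-identityʳ (Y zero) with Y zero
... | true  = s≤s (card-─ (Y ∘ suc) y)
... | false = card-─ (Y ∘ suc) y

card-∪ : ∀ {n} (Z Y : Subset n) → (∀ k → Z k ∧ Y k ≡ false) →
         card (λ k → Z k ∨ Y k) ≡ card Z + card Y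
card-∪ {zero}  Z Y disjoint = refl
card-∪ {suc n} Z Y disjoint with Z zero in z₀ | Y zero in y₀
... | true  | true  with () ← trans (sym (cong₂ _∧_ z₀ y₀)) (disjoint zero)
... | true  | false = cong suc (card-∪ (Z ∘ suc) (Y ∘ suc) (disjoint ∘ suc))
... | false | true  = trans (cong suc (card-∪ (Z ∘ suc) (Y ∘ suc) (disjoint ∘ suc)))
                           (sym (+-suc (card (Z ∘ suc)) (card (Y ∘ suc))))
... | false | false = card-∪ (Z ∘ suc) (Y ∘ suc) (disjoint ∘ suc)

consIf : ∀ {a} {A : Set a} → Bool → A → List A → List A
consIf true  x xs = x ∷ xs
consIf false x xs = xs

private
  filter-tabulate-suc : ∀ {k n} (Y : Subset (suc n)) (g : Fin k → Fin n) →
    filter (λ i → Y i Bool.≟ true) (tabulate (suc ∘ g)) ≡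
    map suc (filter (λ i → Y (suc i) Bool.≟ true) (tabulate g))
  filter-tabulate-suc {zero}  Y g = refl
  filter-tabulate-suc {suc k} Y g with Y (suc (g zero))
  ... | true  = cong (suc (g zero) ∷_) (filter-tabulate-suc Y (g ∘ suc))
  ... | false = filter-tabulate-suc Y (g ∘ suc)

elems-suc : ∀ {n} (Y : Subset (suc n)) → elems Y ≡ consIf (Y zero) zero (map suc (elems (Y ∘ suc)))
elems-suc Y with Y zero
... | true  = cong (zero ∷_) (filter-tabulate-suc Y id)
... | false = filter-tabulate-suc Y id

module _ {n : ℕ} where

  ∈-elems⁺ : {R : Subset n} {k : Fin n} → R k ≡ true → k ∈ elems R
  ∈-elems⁺ Rk = ∈-filter⁺ _ (∈-allFin _) Rk

  ∈-elems⁻ : {R : Subset n} {k : Fin n} → k ∈ elems R → R k ≡ true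
  ∈-elems⁻ {R} k∈R = proj₂ (∈-filter⁻ (λ i → R i Bool.≟ true) {xs = allFin n} k∈R)

  elems-cong : {R R' : Subset n} → (∀ k → R k ≡ R' k) → elems R ≡ elems R'
  elems-cong R≗R' =
    filter-≐ _ _ ((λ p → trans (sym (R≗R' _)) p) , (λ p → trans (R≗R' _) p)) (allFin n)

  elems-full : elems {n} full ≡ allFin n
  elems-full = filter-all _ (All.universal (λ _ → refl) (allFin n))

  elems-empty : elems {n} empty ≡ []
  elems-empty = filter-none _ (All.universal (λ _ ()) (allFin n))

length-elems : ∀ {n} (Y : Subset n) → length (elems Y) ≡ card Y
length-elems {zero}  Y = refl
length-elems {suc n} Y rewrite elems-suc Y with Y zero
... | true  = cong suc (trans (length-map suc (elems (Y ∘ suc))) (length-elems (Y ∘ suc)))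
... | false = trans (length-map suc (elems (Y ∘ suc))) (length-elems (Y ∘ suc))

⊕-elems : ∀ {n} (f : Fin n → Bool) (W : Subset n) → ⊕ (map f (elems W)) ≡ sum (λ k → f k ∧ W k)
⊕-elems {zero}  f W = refl
⊕-elems {suc n} f W rewrite elems-suc W with W zero
... | true  rewrite sym (map-∘ {g = f} {f = suc} (elems (W ∘ suc))) =
  cong₂ _xor_ (sym (∧-identityʳ (f zero))) (⊕-elems (f ∘ suc) (W ∘ suc))
... | false rewrite sym (map-∘ {g = f} {f = suc} (elems (W ∘ suc))) =
  trans (⊕-elems (f ∘ suc) (W ∘ suc))
        (cong (_xor sum (λ k → f (suc k) ∧ W (suc k))) (sym (∧-zeroʳ (f zero))))

sublists-map : ∀ {a b} {A : Set a} {B : Set b} (f : A → B) (xs : List A) →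
               sublists (map f xs) ≡ map (map f) (sublists xs)
sublists-map f []       = refl
sublists-map f (x ∷ xs) = begin
  sublists (map f xs) ++ map (f x ∷_) (sublists (map f xs))
    ≡⟨ cong (λ ys → ys ++ map (f x ∷_) ys) (sublists-map f xs) ⟩
  map (map f) (sublists xs) ++ map (f x ∷_) (map (map f) (sublists xs))
    ≡⟨ cong (map (map f) (sublists xs) ++_)
            (trans (sym (map-∘ (sublists xs))) (map-∘ (sublists xs))) ⟩
  map (map f) (sublists xs) ++ map (map f) (map (x ∷_) (sublists xs))
    ≡⟨ sym (map-++ (map f) (sublists xs) (map (x ∷_) (sublists xs))) ⟩
  map (map f) (sublists xs ++ map (x ∷_) (sublists xs))
    ∎
  where open ≡-Reasoning

◂-⊆ : ∀ {n} {b} {W : Subset n} {X : Subset (suc n)} →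
      (b ≡ true → X zero ≡ true) → W ⊆ X ∘ suc → (b ◂ W) ⊆ X
◂-⊆ b⊆ W⊆ zero    = b⊆
◂-⊆ b⊆ W⊆ (suc k) = W⊆ k

∈-sublists-elems⁻ : ∀ {n} (X : Subset n) {S} → S ∈ sublists (elems X) →
                    ∃ λ W → W ⊆ X × S ≡ elems W

private
  ∈-sublists-shift⁻ : ∀ {n} (X : Subset (suc n)) b → (b ≡ true → X zero ≡ true) →
    ∀ {S} → S ∈ sublists (map suc (elems (X ∘ suc))) → ∃ λ W → W ⊆ X × consIf b zero S ≡ elems W
  ∈-sublists-shift⁻ X b b⊆ {S} S∈
    with ∈-map⁻ (map suc) (subst (S ∈_) (sublists-map suc (elems (X ∘ suc))) S∈)
  ... | S' , S'∈ , refl with ∈-sublists-elems⁻ (X ∘ suc) S'∈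
  ...   | W , W⊆ , refl = b ◂ W , ◂-⊆ b⊆ W⊆ , sym (elems-suc (b ◂ W))

∈-sublists-elems⁻ {zero} X (here refl) = empty , (λ ()) , refl
∈-sublists-elems⁻ {suc n} X S∈ rewrite elems-suc X with X zero in x₀
... | false = ∈-sublists-shift⁻ X false (λ ()) S∈
... | true  with ∈-++⁻ (sublists (map suc (elems (X ∘ suc)))) S∈
...   | inj₁ S∈ˡ = ∈-sublists-shift⁻ X false (λ ()) S∈ˡ
...   | inj₂ S∈ʳ with ∈-map⁻ (zero ∷_) S∈ʳ
...     | S' , S'∈ , refl = ∈-sublists-shift⁻ X true (λ _ → x₀) S'∈

private
  shift-∈-sublists : ∀ {n} {W X : Subset n} → elems W ∈ sublists (elems X) →
                     map (Fin.suc {n}) (elems W) ∈ sublists (map Fin.suc (elems X))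
  shift-∈-sublists {X = X} W∈ =
    subst (_ ∈_) (sym (sublists-map suc (elems X))) (∈-map⁺ (map suc) W∈)

elems-∈-sublists : ∀ {n} {W X : Subset n} → W ⊆ X → elems W ∈ sublists (elems X)
elems-∈-sublists {zero} _ = here refl
elems-∈-sublists {suc n} {W} {X} W⊆X
  rewrite elems-suc W | elems-suc X with W zero in w₀ | X zero in x₀
... | true  | true  = ∈-++⁺ʳ _ (∈-map⁺ (zero ∷_) (shift-∈-sublists (elems-∈-sublists (W⊆X ∘ suc))))
... | true  | false with () ← trans (sym (W⊆X zero w₀)) x₀
... | false | true  = ∈-++⁺ˡ (shift-∈-sublists (elems-∈-sublists (W⊆X ∘ suc)))
... | false | false = shift-∈-sublists (elems-∈-sublists (W⊆X ∘ suc))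

∈⇒nonEmpty : ∀ {a} {A : Set a} {x : A} {xs} → x ∈ xs → nonEmpty xs ≡ true
∈⇒nonEmpty (here _)  = refl
∈⇒nonEmpty (there _) = refl

Independent : ∀ {n} → Mat n → Subset n → Subset n → Set
Independent M R Y = ∀ W → W ⊆ Y → ZeroOn R (M ·ᵥ W) → ∀ k → W k ≡ false

module _ {n : ℕ} (M : Mat n) (R : Subset n) where

  private
    T⇒≡ : ∀ {b} → T b → b ≡ true
    T⇒≡ = Equivalence.to T-≡

    ≡⇒T : ∀ {b} → b ≡ true → T b
    ≡⇒T = Equivalence.from T-≡

    columnSum : Subset n → Fin n → Bool
    columnSum W r = ⊕ (map (M r) (elems W))

  sumNonzero≡false⇒ZeroOn : ∀ W → sumNonzero M (elems R) (elems W) ≡ false → ZeroOn R (M ·ᵥ W)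
  sumNonzero≡false⇒ZeroOn W none r Rr with (M ·ᵥ W) r in MWr
  ... | false = refl
  ... | true  = case subst T none (any⁺ (columnSum W) (lose (∈-elems⁺ Rr) column≢0)) of λ ()
    where
    column≢0 : T (columnSum W r)
    column≢0 = ≡⇒T (trans (⊕-elems (M r) W) MWr)

  ZeroOn⇒sumNonzero≡false : ∀ W → ZeroOn R (M ·ᵥ W) → sumNonzero M (elems R) (elems W) ≡ false
  ZeroOn⇒sumNonzero≡false W W-null with sumNonzero M (elems R) (elems W) in some
  ... | false = refl
  ... | true  with find (any⁻ (columnSum W) (elems R) (≡⇒T some))
  ...   | r , r∈R , column≢0 = case trans (sym MWr≡true) (W-null r (∈-elems⁻ r∈R)) of λ ()
    where
    MWr≡true : (M ·ᵥ W) r ≡ true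
    MWr≡true = trans (sym (⊕-elems (M r) W)) (T⇒≡ column≢0)

  independent⇒Independent : ∀ {Y} → independent M (elems R) (elems Y) ≡ true → Independent M R Y
  independent⇒Independent {Y} ind W W⊆Y W-null k with W k in Wk
  ... | false = refl
  ... | true  = case subst T (ZeroOn⇒sumNonzero≡false W W-null) clause of λ ()
    where
    clause : T (sumNonzero M (elems R) (elems W))
    clause = subst (λ b → T (not b ∨ sumNonzero M (elems R) (elems W))) (∈⇒nonEmpty (∈-elems⁺ Wk))
                   (All.lookup (all⁺ _ _ (≡⇒T ind)) (elems-∈-sublists W⊆Y))

  Independent⇒independent : ∀ {Y} → Independent M R Y → independent M (elems R) (elems Y) ≡ true
  Independent⇒independent {Y} ind = T⇒≡ (all⁻ _ (All.tabulate clause))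
    where
    clause : ∀ {S} → S ∈ sublists (elems Y) → T (not (nonEmpty S) ∨ sumNonzero M (elems R) S)
    clause S∈ with ∈-sublists-elems⁻ Y S∈
    ... | W , W⊆Y , refl with sumNonzero M (elems R) (elems W) in nz
    ...   | true  = ≡⇒T (∨-zeroʳ _)
    ...   | false
      rewrite elems-cong (ind W W⊆Y (sumNonzero≡false⇒ZeroOn W nz)) | elems-empty {n} = _

≤-maximum : ∀ {x} xs → x ∈ xs → x ≤ maximum xs
≤-maximum (y ∷ xs) (here refl) = m≤m⊔n y (maximum xs)
≤-maximum (y ∷ xs) (there x∈)  = ≤-trans (≤-maximum xs x∈) (m≤n⊔m y (maximum xs))

maximum-∈ : ∀ xs → maximum xs ≡ 0 ⊎ maximum xs ∈ xs
maximum-∈ []       = inj₁ refl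
maximum-∈ (y ∷ xs) with ⊔-sel y (maximum xs)
... | inj₁ y⊔≡y = inj₂ (subst (_∈ y ∷ xs) (sym y⊔≡y) (here refl))
... | inj₂ y⊔≡m with maximum-∈ xs
...   | inj₁ m≡0 = inj₁ (trans y⊔≡m m≡0)
...   | inj₂ m∈  = inj₂ (subst (_∈ y ∷ xs) (sym y⊔≡m) (there m∈))

ρ : ∀ {n} → Mat n → Subset n → Subset n → ℕ
ρ M R X = rankOn M (elems R) (elems X)

module _ {n : ℕ} (M : Mat n) (R X : Subset n) where

  private
    independentSizes : List ℕ
    independentSizes =
      map length (filter (λ S → independent M (elems R) S Bool.≟ true) (sublists (elems X)))

  card-≤-ρ : ∀ {Y} → Y ⊆ X → Independent M R Y → card Y ≤ ρ M R X
  card-≤-ρ {Y} Y⊆X ind = subst (_≤ ρ M R X) (length-elems Y)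
    (≤-maximum independentSizes
      (∈-map⁺ length (∈-filter⁺ _ (elems-∈-sublists Y⊆X) (Independent⇒independent M R ind))))

  ρ-witness : ∃ λ Y → Y ⊆ X × Independent M R Y × card Y ≡ ρ M R X
  ρ-witness with maximum-∈ independentSizes
  ... | inj₁ ρ≡0 = empty , (λ _ ()) , (λ W W⊆∅ _ → ⊆-empty W⊆∅) , trans (card-empty n) (sym ρ≡0)
  ... | inj₂ ρ∈ with ∈-map⁻ length ρ∈
  ...   | S , S∈ , ρ≡ with ∈-filter⁻ _ {xs = sublists (elems X)} S∈
  ...     | S∈′ , indS with ∈-sublists-elems⁻ X S∈′
  ...       | Y , Y⊆X , refl =
    Y , Y⊆X , independent⇒Independent M R indS , trans (sym (length-elems Y)) (sym ρ≡)

card-≤ : ∀ {n} (Y : Subset n) → card Y ≤ n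
card-≤ Y = subst (card Y ≤_) (card-complement Y) (m≤m+n (card Y) _)

module _ {n : ℕ} where

  ρ-≤ : ∀ {M M' : Mat n} {R R' X X' : Subset n} →
        (∀ {Y} → Y ⊆ X → Independent M R Y → Y ⊆ X' × Independent M' R' Y) → ρ M R X ≤ ρ M' R' X'
  ρ-≤ {M} {M'} {R} {R'} {X} {X'} transfer with ρ-witness M R X
  ... | Y , Y⊆X , ind , cardY with transfer Y⊆X ind
  ...   | Y⊆X' , ind' = subst (_≤ ρ M' R' X') cardY (card-≤-ρ M' R' X' Y⊆X' ind')

  ρ-≤-size : ∀ (M : Mat n) R X → ρ M R X ≤ n
  ρ-≤-size M R X with ρ-witness M R X
  ... | Y , _ , _ , cardY = subst (_≤ n) cardY (card-≤ Y)

  ρ-cong-subsets : ∀ (M : Mat n) {R R' X X'} → (∀ k → R k ≡ R' k) → (∀ k → X k ≡ X' k) →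
                   ρ M R X ≡ ρ M R' X'
  ρ-cong-subsets M R≗R' X≗X' = cong₂ (rankOn M) (elems-cong R≗R') (elems-cong X≗X')

  ρ-cong-entries : ∀ {M M' : Mat n} {R X} → (∀ r k → R r ≡ true → X k ≡ true → M r k ≡ M' r k) →
                   ρ M R X ≡ ρ M' R X
  ρ-cong-entries {M} {M'} {R} {X} M≡M' =
    ≤-antisym (ρ-≤ (λ Y⊆X ind → Y⊆X , transfer M≡M' Y⊆X ind))
              (ρ-≤ (λ Y⊆X ind → Y⊆X , transfer (λ r k Rr Xk → sym (M≡M' r k Rr Xk)) Y⊆X ind))
    where
    transfer : ∀ {M M'} → (∀ r k → R r ≡ true → X k ≡ true → M r k ≡ M' r k) →
               ∀ {Y} → Y ⊆ X → Independent M R Y → Independent M' R Y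
    transfer {M} {M'} M≡M' Y⊆X ind W W⊆Y W-null =
      ind W W⊆Y (λ r Rr → trans (sum-cong-≗ (same-terms r Rr)) (W-null r Rr))
      where
      same-terms : ∀ r → R r ≡ true → ∀ k → M r k ∧ W k ≡ M' r k ∧ W k
      same-terms r Rr k with W k in Wk
      ... | false = trans (∧-zeroʳ _) (sym (∧-zeroʳ _))
      ... | true  = cong (_∧ true) (M≡M' r k Rr (Y⊆X k (W⊆Y k Wk)))

  rank≡ρ : ∀ (M : Mat n) → rank M ≡ ρ M full full
  rank≡ρ M = sym (cong₂ (rankOn M) elems-full elems-full)

  ρ-leftInvertible : ∀ {A B : Mat n} → (B · A) ≐ identity → ρ A full full ≡ n
  ρ-leftInvertible {A} BA≐I = ≤-antisym (ρ-≤-size A full full)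
    (subst (_≤ ρ A full full) (card-full n) (card-≤-ρ A full full (λ _ _ → refl)
      (λ W _ AW≡0 → leftInvertible⇒kernel-zero BA≐I W (λ r → AW≡0 r refl))))

  ρ-·-leftInvertible : ∀ {A B : Mat n} (M : Mat n) → (B · A) ≐ identity →
                       ρ (A · M) full full ≡ ρ M full full
  ρ-·-leftInvertible {A} M BA≐I = ≤-antisym
    (ρ-≤ (λ Y⊆X ind → Y⊆X , λ W W⊆Y MW≡0 →
      ind W W⊆Y (λ r _ → trans (·-·ᵥ A M W r) (·ᵥ-zero A (λ k → MW≡0 k refl) r))))
    (ρ-≤ (λ Y⊆X ind → Y⊆X , λ W W⊆Y AMW≡0 →
      ind W W⊆Y (λ r _ → leftInvertible⇒kernel-zero BA≐I (M ·ᵥ W)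
                           (λ k → trans (sym (·-·ᵥ A M W k)) (AMW≡0 k refl)) r)))

◂-cong : ∀ {n} {b} {W W' : Subset n} → (∀ k → W k ≡ W' k) → ∀ k → (b ◂ W) k ≡ (b ◂ W') k
◂-cong W≗W' zero    = refl
◂-cong W≗W' (suc k) = W≗W' k

any-subset? : ∀ n (P : Subset n → Set) → (∀ W → Dec (P W)) →
              (∀ {W W'} → (∀ k → W k ≡ W' k) → P W → P W') → Dec (∃ P)
any-subset? zero P P? resp with P? empty
... | yes p = yes (empty , p)
... | no ¬p = no λ (W , p) → ¬p (resp (λ ()) p)
any-subset? (suc n) P P? resp
  with any-subset? n (λ W → P (false ◂ W) ⊎ P (true ◂ W))
         (λ W → P? (false ◂ W) ⊎-dec P? (true ◂ W))
         (λ W≗W' → Sum.map (resp (◂-cong W≗W')) (resp (◂-cong W≗W')))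
... | yes (_ , inj₁ p) = yes (_ , p)
... | yes (_ , inj₂ p) = yes (_ , p)
... | no ¬∃ = no λ (W , p) → ¬∃ (W ∘ suc , split W p)
  where
  split : ∀ W → P W → P (false ◂ W ∘ suc) ⊎ P (true ◂ W ∘ suc)
  split W p with W zero in w₀
  ... | false = inj₁ (resp (λ { zero → w₀ ; (suc k) → refl }) p)
  ... | true  = inj₂ (resp (λ { zero → w₀ ; (suc k) → refl }) p)

module _ {n : ℕ} where

  ─-⊆ : ∀ {Y : Subset n} {y} → Y ─ y ⊆ Y
  ─-⊆ {Y} k p with Y k
  ... | true  = refl
  ... | false = p

  ─-excludes : ∀ {W Y : Subset n} {y} → W ⊆ Y ─ y → W y ≡ false
  ─-excludes {W} {Y} {y} W⊆ with W y in Wy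
  ... | false = refl
  ... | true  = case trans (sym (W⊆ y Wy)) y∉Y─y of λ ()
    where
    y∉Y─y : (Y ─ y) y ≡ false
    y∉Y─y = trans (cong (λ b → Y y ∧ not b) (==-refl y)) (∧-zeroʳ (Y y))

  ∈-─ : ∀ {R : Subset n} {r k} → R k ≡ true → (k == r) ≡ false → (R ─ r) k ≡ true
  ∈-─ {R} {k = k} Rk k≠r = trans (cong (λ b → R k ∧ not b) k≠r) (trans (∧-identityʳ (R k)) Rk)

  ZeroOn-─ : ∀ {R : Subset n} {r v} → v r ≡ false → ZeroOn (R ─ r) v → ZeroOn R v
  ZeroOn-─ {R} {r} {v} vr≡0 v≡0 k Rk with k == r in k=r
  ... | true  = subst (λ j → v j ≡ false) (sym (==⇒≡ k=r)) vr≡0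
  ... | false = v≡0 k (∈-─ {R = R} Rk k=r)

  Independent-rows : ∀ {N : Mat n} {R R' Y} → R ⊆ R' → Independent N R Y → Independent N R' Y
  Independent-rows R⊆R' ind W W⊆Y W-null = ind W W⊆Y (λ r Rr → W-null r (R⊆R' r Rr))

-- If Y stays independent on the rows R ─ r it is kept.  Otherwise a dependency W of Y on R ─ r
-- is nonzero at row r, and any column y of W can be dropped: a dependency U of Y ─ y on R ─ r is
-- also nonzero at r, so U xor W would be a dependency of Y on all of R containing y.
module _ {n : ℕ} (N : Mat n) {R Y : Subset n} (ind : Independent N R Y) (r : Fin n) where

  private
    Dependency : Subset n → Set
    Dependency W = W ⊆ Y × ZeroOn (R ─ r) (N ·ᵥ W) × ∃ λ k → W k ≡ true

    dependency? : ∀ W → Dec (Dependency W)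
    dependency? W = Fin.all? (λ k → (W k Bool.≟ true) →-dec (Y k Bool.≟ true))
              ×-dec Fin.all? (λ k → ((R ─ r) k Bool.≟ true) →-dec ((N ·ᵥ W) k Bool.≟ false))
              ×-dec Fin.any? (λ k → W k Bool.≟ true)

    Dependency-resp : ∀ {W W'} → (∀ k → W k ≡ W' k) → Dependency W → Dependency W'
    Dependency-resp W≗W' (W⊆Y , W-null , k , Wk) =
      (λ j p → W⊆Y j (trans (W≗W' j) p)) ,
      (λ j p → trans (sym (·ᵥ-congʳ N W≗W' j)) (W-null j p)) ,
      k , trans (sym (W≗W' k)) Wk

    dependency-hits-r : ∀ {W} → Dependency W → (N ·ᵥ W) r ≡ true
    dependency-hits-r {W} (W⊆Y , W-null , k , Wk) with (N ·ᵥ W) r in NWr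
    ... | true  = refl
    ... | false with () ← trans (sym (ind W W⊆Y (ZeroOn-─ NWr W-null) k)) Wk

    drop-column : ∀ {W y} → Dependency W → W y ≡ true → Independent N (R ─ r) (Y ─ y)
    drop-column {W} {y} dep@(W⊆Y , W-null , _) Wy U U⊆ U-null k with (N ·ᵥ U) r in NUr
    ... | false = ind U (λ j p → ─-⊆ {Y = Y} j (U⊆ j p)) (ZeroOn-─ NUr U-null) k
    ... | true  = case trans (sym (cong₂ _xor_ (─-excludes U⊆) Wy)) (ind V V⊆Y V-null y) of λ ()
      where
      V : Subset n
      V j = U j xor W j

      V⊆Y : V ⊆ Y
      V⊆Y j p  with U j in Uj | W j in Wj
      V⊆Y j p  | true  | _     = ─-⊆ {Y = Y} j (U⊆ j Uj)
      V⊆Y j p  | false | true  = W⊆Y j Wj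
      V⊆Y j () | false | false

      V-null : ZeroOn R (N ·ᵥ V)
      V-null j Rj with j == r in j=r
      ... | true  = subst (λ i → (N ·ᵥ V) i ≡ false) (sym (==⇒≡ j=r))
                      (trans (·ᵥ-xor N U W r) (cong₂ _xor_ NUr (dependency-hits-r dep)))
      ... | false = trans (·ᵥ-xor N U W j)
                      (cong₂ _xor_ (U-null j (∈-─ {R = R} Rj j=r)) (W-null j (∈-─ {R = R} Rj j=r)))

  Independent-─ : ∃ λ Y₁ → Y₁ ⊆ Y × Independent N (R ─ r) Y₁ × card Y ≤ suc (card Y₁)
  Independent-─ with any-subset? n Dependency dependency? Dependency-resp
  ... | yes (W , dep@(_ , _ , y , Wy)) = Y ─ y , ─-⊆ , drop-column dep Wy , card-─ Y y
  ... | no ¬dep = Y , (λ _ p → p) , still-independent , n≤1+n _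
    where
    still-independent : Independent N (R ─ r) Y
    still-independent W W⊆Y W-null k with W k in Wk
    ... | false = refl
    ... | true  with () ← ¬dep (W , W⊆Y , W-null , k , Wk)

infixl 6 _─ₗ_

_─ₗ_ : ∀ {n} → Subset n → List (Fin n) → Subset n
R ─ₗ []       = R
R ─ₗ (d ∷ ds) = (R ─ₗ ds) ─ d

∈⇒∉-─ₗ : ∀ {n} (R : Subset n) {k} ds → k ∈ ds → (R ─ₗ ds) k ≡ false
∈⇒∉-─ₗ R {k} (d ∷ ds) (here refl) = trans (cong (λ b → (R ─ₗ ds) k ∧ not b) (==-refl k)) (∧-zeroʳ _)
∈⇒∉-─ₗ R {k} (d ∷ ds) (there k∈) rewrite ∈⇒∉-─ₗ R ds k∈ = refl

Independent-─ₗ : ∀ {n} (N : Mat n) {R Y : Subset n} → Independent N R Y → ∀ ds →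
  ∃ λ Y₁ → Y₁ ⊆ Y × Independent N (R ─ₗ ds) Y₁ × card Y ≤ length ds + card Y₁
Independent-─ₗ N {Y = Y} ind [] = Y , (λ _ p → p) , ind , ≤-refl
Independent-─ₗ N ind (d ∷ ds) with Independent-─ₗ N ind ds
... | Y₁ , Y₁⊆Y , ind₁ , card₁ with Independent-─ N ind₁ d
...   | Y₂ , Y₂⊆Y₁ , ind₂ , card₂ =
  Y₂ , (λ k p → Y₁⊆Y k (Y₂⊆Y₁ k p)) , ind₂ ,
  ≤-trans card₁ (subst (length ds + card Y₁ ≤_) (+-suc (length ds) (card Y₂))
                       (+-monoʳ-≤ (length ds) card₂))

UnitColumns : ∀ {n} → Mat n → Subset n → Set
UnitColumns N Z = ∀ r z → Z z ≡ true → N r z ≡ (r == z)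

⁅_⁆ : ∀ {n} → Fin n → Subset n
⁅ k ⁆ j = j == k

-- On the rows outside Z the unit columns Z vanish, which decouples them from the block N[Zᶜ].
module _ {n : ℕ} {N : Mat n} {Z : Subset n} (unit : UnitColumns N Z) where

  private
    unit-outside : ∀ {r k} → complement Z r ≡ true → Z k ≡ true → N r k ≡ false
    unit-outside {r} {k} Zᶜr Zk with r == k in r=k
    ... | false = trans (unit r k Zk) r=k
    ... | true  = case trans (sym (trans (cong Z (==⇒≡ r=k)) Zk)) (complement-true Z Zᶜr) of λ ()

  Independent-outside⇒⊆ : ∀ {Y} → Independent N (complement Z) Y → Y ⊆ complement Z
  Independent-outside⇒⊆ {Y} ind k Yk with Z k in Zk
  ... | false = refl
  ... | true  = case trans (sym (==-refl k)) (ind ⁅ k ⁆ k⊆Y k-null k) of λ ()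
    where
    k⊆Y : ⁅ k ⁆ ⊆ Y
    k⊆Y j j=k = subst (λ i → Y i ≡ true) (sym (==⇒≡ j=k)) Yk

    k-null : ZeroOn (complement Z) (N ·ᵥ ⁅ k ⁆)
    k-null r Zᶜr = trans (sum-δʳ (N r) k) (unit-outside Zᶜr Zk)

  Independent-unitColumns-∪ : ∀ {Y} → Independent N (complement Z) Y →
                              Independent N full (λ k → Z k ∨ Y k)
  Independent-unitColumns-∪ {Y} ind W W⊆ W-null k = trans (sym (N·W≗W k)) (W-null k refl)
    where
    W' : Subset n
    W' j = W j ∧ not (Z j)

    W'⊆Y : W' ⊆ Y
    W'⊆Y j p with Z j in Zj | W j in Wj
    W'⊆Y j p  | false | true  = subst (λ b → b ∨ Y j ≡ true) Zj (W⊆ j Wj)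
    W'⊆Y j () | false | false
    W'⊆Y j p  | true  | b     = case trans (sym p) (∧-zeroʳ b) of λ ()

    W'-null : ZeroOn (complement Z) (N ·ᵥ W')
    W'-null r Zᶜr = trans (sum-cong-≗ same-terms) (W-null r refl)
      where
      same-terms : ∀ j → N r j ∧ W' j ≡ N r j ∧ W j
      same-terms j with Z j in Zj
      ... | false = cong (N r j ∧_) (∧-identityʳ (W j))
      ... | true  rewrite unit-outside Zᶜr Zj = refl

    W⊆Z : ∀ j → Z j ≡ false → W j ≡ false
    W⊆Z j Zj = trans (sym (∧-identityʳ (W j)))
                     (trans (cong (λ b → W j ∧ not b) (sym Zj)) (ind W' W'⊆Y W'-null j))

    N·W≗W : ∀ k → (N ·ᵥ W) k ≡ W k
    N·W≗W k = trans (sum-cong-≗ unit-terms) (sum-δˡ W k)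
      where
      unit-terms : ∀ j → N k j ∧ W j ≡ (k == j) ∧ W j
      unit-terms j with Z j in Zj
      ... | true  = cong (_∧ W j) (unit k j Zj)
      ... | false rewrite W⊆Z j Zj = trans (∧-zeroʳ (N k j)) (sym (∧-zeroʳ (k == j)))

  ρ-unitColumns-≤ : ρ N full full ≤ card Z + ρ N (complement Z) (complement Z)
  ρ-unitColumns-≤ with ρ-witness N full full
  ... | Y , _ , ind , cardY with Independent-─ₗ N ind (elems Z)
  ...   | Y₁ , _ , ind₁ , card₁ = begin
    ρ N full full
      ≡⟨ sym cardY ⟩
    card Y
      ≤⟨ card₁ ⟩
    length (elems Z) + card Y₁
      ≡⟨ cong (_+ card Y₁) (length-elems Z) ⟩
    card Z + card Y₁
      ≤⟨ +-monoʳ-≤ (card Z) (card-≤-ρ N _ _ (Independent-outside⇒⊆ ind′) ind′) ⟩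
    card Z + ρ N (complement Z) (complement Z)
      ∎
    where
    open ≤-Reasoning

    rows⊆ : full ─ₗ elems Z ⊆ complement Z
    rows⊆ k p with Z k in Zk
    ... | false = refl
    ... | true  = case trans (sym p) (∈⇒∉-─ₗ full (elems Z) (∈-elems⁺ Zk)) of λ ()

    ind′ : Independent N (complement Z) Y₁
    ind′ = Independent-rows rows⊆ ind₁

  ρ-unitColumns-≥ : card Z + ρ N (complement Z) (complement Z) ≤ ρ N full full
  ρ-unitColumns-≥ with ρ-witness N (complement Z) (complement Z)
  ... | Y , Y⊆Zᶜ , ind , cardY =
    subst (_≤ ρ N full full) (trans (card-∪ Z Y disjoint) (cong (card Z +_) cardY))
          (card-≤-ρ N full full (λ _ _ → refl) (Independent-unitColumns-∪ ind))
    where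
    disjoint : ∀ k → Z k ∧ Y k ≡ false
    disjoint k with Z k in Zk | Y k in Yk
    ... | false | _     = refl
    ... | true  | false = refl
    ... | true  | true  = case trans (sym Zk) (complement-true Z (Y⊆Zᶜ k Yk)) of λ ()

  ρ-unitColumns : ρ N full full ≡ card Z + ρ N (complement Z) (complement Z)
  ρ-unitColumns = ≤-antisym ρ-unitColumns-≤ ρ-unitColumns-≥

module _ where
  open Data.Integer using (+_)

  pos-cancel : ∀ x c r → + (x + c) Int.- (+ x Int.- + r) ≡ + (c + r)
  pos-cancel x c r
    rewrite IntP.pos-+ x c | IntP.pos-+ c r = cancel (+ x) (+ c) (+ r)
    where
    cancel : ∀ x c r → (x Int.+ c) Int.- (x Int.- r) ≡ c Int.+ r
    cancel = solve-∀

  pos-trade : ∀ x a c b r → x + a ≡ c + b → + r Int.+ + a ≡ + (c + r) Int.- (+ x Int.- + b)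
  pos-trade x a c b r x+a≡c+b rewrite IntP.pos-+ c r = begin
    + r Int.+ + a                          ≡⟨ add-sub (+ x) (+ r) (+ a) ⟩
    + r Int.+ ((+ x Int.+ + a) Int.- + x)  ≡⟨ cong (λ t → + r Int.+ (t Int.- + x)) x+a≡c+bᶻ ⟩
    + r Int.+ ((+ c Int.+ + b) Int.- + x)  ≡⟨ regroup (+ x) (+ c) (+ b) (+ r) ⟩
    (+ c Int.+ + r) Int.- (+ x Int.- + b)  ∎
    where
    open ≡-Reasoning
    x+a≡c+bᶻ : + x Int.+ + a ≡ + c Int.+ + b
    x+a≡c+bᶻ = trans (sym (IntP.pos-+ x a)) (trans (cong +_ x+a≡c+b) (IntP.pos-+ c b))
    add-sub : ∀ x r a → r Int.+ a ≡ r Int.+ ((x Int.+ a) Int.- x)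
    add-sub = solve-∀
    regroup : ∀ x c b r → r Int.+ ((c Int.+ b) Int.- x) ≡ (c Int.+ r) Int.- (x Int.- b)
    regroup = solve-∀

module _ {n : ℕ} {A B : Mat n} (AB≐I : (A · B) ≐ identity) (BA≐I : (B · A) ≐ identity) where

  private
    ρ-complement² : ∀ (M : Mat n) X →
                    ρ M (complement (complement X)) (complement (complement X)) ≡ ρ M X X
    ρ-complement² M X = ρ-cong-subsets M (not-involutive ∘ X) (not-involutive ∘ X)

    A·[B+I]-entry : ∀ X r k → (A · (B +M diagI X)) r k ≡ (r == k) xor (A r k ∧ X k)
    A·[B+I]-entry X r k = begin
      (A · (B +M diagI X)) r k
        ≡⟨ ·-entry A (B +M diagI X) r k ⟩
      sum (λ j → A r j ∧ (B j k xor ((j == k) ∧ X j)))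
        ≡⟨ sum-cong-≗ (λ j → ∧-distribˡ-xor (A r j) (B j k) ((j == k) ∧ X j)) ⟩
      sum (λ j → (A r j ∧ B j k) xor (A r j ∧ ((j == k) ∧ X j)))
        ≡⟨ ∑-distrib-+ (λ j → A r j ∧ B j k) (λ j → A r j ∧ ((j == k) ∧ X j)) ⟩
      sum (λ j → A r j ∧ B j k) xor sum (λ j → A r j ∧ ((j == k) ∧ X j))
        ≡⟨ cong₂ _xor_ (trans (sym (·-entry A B r k)) (AB≐I r k))
                       (sum-cong-≗ (λ j → swap-∧ (A r j) (j == k) (X j))) ⟩
      (r == k) xor sum (λ j → (A r j ∧ X j) ∧ (j == k))
        ≡⟨ cong ((r == k) xor_) (sum-δʳ (λ j → A r j ∧ X j) k) ⟩
      (r == k) xor (A r k ∧ X k)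
        ∎
      where
      open ≡-Reasoning
      swap-∧ : ∀ a b c → a ∧ (b ∧ c) ≡ (a ∧ c) ∧ b
      swap-∧ a b c = trans (cong (a ∧_) (∧-comm b c)) (sym (∧-assoc a c b))

  rank-inverse+diag : ∀ X → rank (B +M diagI X) ≡ card (complement X) + ρ (A +M diagI X) X X
  rank-inverse+diag X = begin
    rank (B +M diagI X)
      ≡⟨ rank≡ρ (B +M diagI X) ⟩
    ρ (B +M diagI X) full full
      ≡⟨ sym (ρ-·-leftInvertible (B +M diagI X) BA≐I) ⟩
    ρ N full full
      ≡⟨ ρ-unitColumns unit ⟩
    card (complement X) + ρ N (complement (complement X)) (complement (complement X))
      ≡⟨ cong (card (complement X) +_) (trans (ρ-complement² N X) (ρ-cong-entries N≡A+I)) ⟩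
    card (complement X) + ρ (A +M diagI X) X X
      ∎
    where
    open ≡-Reasoning
    N : Mat n
    N = A · (B +M diagI X)

    unit : UnitColumns N (complement X)
    unit r z Xᶜz = begin
      N r z                         ≡⟨ A·[B+I]-entry X r z ⟩
      (r == z) xor (A r z ∧ X z)    ≡⟨ cong (λ b → (r == z) xor (A r z ∧ b)) (complement-true X Xᶜz) ⟩
      (r == z) xor (A r z ∧ false)  ≡⟨ cong ((r == z) xor_) (∧-zeroʳ (A r z)) ⟩
      (r == z) xor false            ≡⟨ xor-identityʳ (r == z) ⟩
      r == z                        ∎

    N≡A+I : ∀ r k → X r ≡ true → X k ≡ true → N r k ≡ (A +M diagI X) r k
    N≡A+I r k Xr Xk
      rewrite A·[B+I]-entry X r k | Xr | Xk | ∧-identityʳ (A r k) | ∧-identityʳ (r == k) =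
      xor-comm (r == k) (A r k)

  complementary-minors : ∀ X →
    card (complement X) + ρ A X X ≡ card X + ρ B (complement X) (complement X)
  complementary-minors X = begin
    card (complement X) + ρ A X X
      ≡⟨ cong (card (complement X) +_)
              (sym (trans (ρ-complement² (A · E) X) (ρ-cong-entries A·E≡A))) ⟩
    card (complement X) + ρ (A · E) (complement (complement X)) (complement (complement X))
      ≡⟨ sym (ρ-unitColumns unit-A·E) ⟩
    ρ (A · E) full full
      ≡⟨ ρ-·-leftInvertible E BA≐I ⟩
    ρ E full full
      ≡⟨ ρ-unitColumns unit-E ⟩
    card X + ρ E (complement X) (complement X)
      ≡⟨ cong (card X +_) (ρ-cong-entries E≡B) ⟩
    card X + ρ B (complement X) (complement X)
      ∎
    where
    open ≡-Reasoning
    E : Mat n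
    E r k = if X k then r == k else B r k

    A·E-entry : ∀ r k → (A · E) r k ≡ (if X k then A r k else r == k)
    A·E-entry r k = trans (·-entry A E r k) (column (X k))
      where
      column : ∀ b → sum (λ j → A r j ∧ (if b then j == k else B j k)) ≡
                     (if b then A r k else r == k)
      column true  = sum-δʳ (A r) k
      column false = trans (sym (·-entry A B r k)) (AB≐I r k)

    unit-A·E : UnitColumns (A · E) (complement X)
    unit-A·E r z Xᶜz rewrite A·E-entry r z | complement-true X Xᶜz = refl

    A·E≡A : ∀ r k → X r ≡ true → X k ≡ true → (A · E) r k ≡ A r k
    A·E≡A r k _ Xk rewrite A·E-entry r k | Xk = refl

    unit-E : UnitColumns E X
    unit-E r z Xz rewrite Xz = refl

    E≡B : ∀ r k → complement X r ≡ true → complement X k ≡ true → E r k ≡ B r k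
    E≡B r k _ Xᶜk rewrite complement-true X Xᶜk = refl

  r-τδτ≡r-τ-inverse : ∀ X → r-τδτ A X ≡ r-τ B X
  r-τδτ≡r-τ-inverse X = begin
    + rank A Int.- (+ length (elems X) Int.- + r)
      ≡⟨ cong₂ (λ a x → + a Int.- (+ x Int.- + r)) rank-A (length-elems X) ⟩
    + (card X + card (complement X)) Int.- (+ card X Int.- + r)
      ≡⟨ pos-cancel (card X) (card (complement X)) r ⟩
    + (card (complement X) + r)
      ≡⟨ cong +_ (sym (rank-inverse+diag X)) ⟩
    + rank (B +M diagI X)
      ∎
    where
    open ≡-Reasoning
    open Data.Integer using (+_)
    r : ℕ
    r = ρ (A +M diagI X) X X

    rank-A : rank A ≡ card X + card (complement X)
    rank-A = trans (rank≡ρ A) (trans (ρ-leftInvertible BA≐I) (sym (card-complement X)))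

  r-δτ≡r-τδ-inverse : ∀ X → r-δτ A X ≡ r-τδ B X
  r-δτ≡r-τδ-inverse X = begin
    + r Int.+ + ρ A Xᶜ Xᶜ
      ≡⟨ pos-trade (card X) (ρ A Xᶜ Xᶜ) (card Xᶜ) (ρ B X X) r minors ⟩
    + (card Xᶜ + r) Int.- (+ card X Int.- + ρ B X X)
      ≡⟨ cong₂ (λ m x → + m Int.- (+ x Int.- + ρ B X X))
               (sym (rank-inverse+diag X)) (sym (length-elems X)) ⟩
    + rank (B +M diagI X) Int.- (+ length (elems X) Int.- + ρ B X X)
      ∎
    where
    open ≡-Reasoning
    open Data.Integer using (+_)
    Xᶜ : Subset n
    Xᶜ = complement X
    r : ℕ
    r = ρ (A +M diagI X) X X

    minors : card X + ρ A Xᶜ Xᶜ ≡ card Xᶜ + ρ B X X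
    minors = begin
      card X + ρ A Xᶜ Xᶜ
        ≡⟨ cong (_+ ρ A Xᶜ Xᶜ) (card-cong (sym ∘ not-involutive ∘ X)) ⟩
      card (complement Xᶜ) + ρ A Xᶜ Xᶜ
        ≡⟨ complementary-minors Xᶜ ⟩
      card Xᶜ + ρ B (complement Xᶜ) (complement Xᶜ)
        ≡⟨ cong (λ m → card Xᶜ + m) (ρ-complement² B X) ⟩
      card Xᶜ + ρ B X X
        ∎

coeffP-cong : ∀ {n} (r r' : Mat n → Subset n → ℤ) (M M' : Mat n) →
              (∀ X → r M X ≡ r' M' X) → coeffP r M ≈P coeffP r' M'
coeffP-cong {n} r r' M M' r≡r' k =
  cong length (filter-≐ (λ X → r M X Int.≟ k) (λ X → r' M' X Int.≟ k)
                        ((λ p → trans (sym (r≡r' _)) p) , (λ q → trans (r≡r' _) q)) (allSubsets n))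

corollary5p8 : ∀ {n : ℕ} (G G' : Graft n)
    → IsInverseOf (adjMat G') (adjMat G)
    → (P-τδτ G ≈P P-τ G') × (P-δτ G ≈P P-τδ G')
corollary5p8 G G' (AB≐I , BA≐I) =
  coeffP-cong r-τδτ r-τ  (adjMat G) (adjMat G') (r-τδτ≡r-τ-inverse AB≐I BA≐I) ,
  coeffP-cong r-δτ  r-τδ (adjMat G) (adjMat G') (r-δτ≡r-τδ-inverse AB≐I BA≐I)
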